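{- For an integer $n\ge 2$, let $X_n$ be the orientable map with two vertices $u$ and $v$ and $n$ edges $e_1,\dots,e_n$, each joining $u$ and $v$, whose rotation system (clockwise cyclic order of edges around each vertex) is $(e_1,e_2,\dots,e_n)$ at $u$ and $(e_1,e_2,\dots,e_n)$ at $v$. Then in the vertex-face walk on $X_n$ there is perfect state transfer from $u$ to $v$ at time $1$, i.e. $U\hat Ne_u=\hat Ne_v$.
   Context: An orientable map is a 2-cell embedding of a connected multigraph in a closed orientable surface; it is determined up to homeomorphism by its rotation system. Each edge gives rise to two arcs on opposite sides of it, pointing in opposite directions; each arc lies in a face and is oriented along the clockwise facial walk of that face. Let $\mathcal A$ be the set of arcs, $v(a)$ the tail vertex and $f(a)$ the face of arc $a$. Let $N\in\{0,1\}^{\mathcal A\times V}$ with $N(a,w)=1$ iff $w=v(a)$, $M\in\{0,1\}^{\mathcal A\times F}$ with $M(a,f)=1$ iff $f=f(a)$, $D=N^TN$, $\Delta=M^TM$, $\hat N=ND^{ -1/2}$, $\hat M=M\Delta^{ -1/2}$, $Q=\hat N\hat N^T$, $P=\hat M\hat M^T$, $U=(2P-I)(2Q-I)$. $e_w$ denotes the standard basis vector of $\mathbb{C}^V$ indexed by $w$. -}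

module Defs where

open import Level using (Level)
open import Data.Nat as ℕ using (ℕ; zero; suc)
open import Data.Fin as Fin using (Fin; zero; suc; toℕ)
open import Data.Fin.Properties as FinP using ()
open import Data.Product using (_×_; _,_; proj₁; proj₂)
open import Data.Product.Properties using (≡-dec)
open import Data.Bool using (Bool; true; false; if_then_else_; _∧_; _∨_; not)
open import Relation.Nullary.Decidable using (⌊_⌋)
open import Algebra.Bundles using (CommutativeRing)
import Algebra.Definitions.RawMonoid as RawMonoidDefs

Vtx : Set
Vtx = Fin 2

u v : Vtx
u = zero
v = suc zero

other : Vtx → Vtx
other zero = suc zero
other (suc zero) = zero

-- cyclic successor i ↦ i+1 (mod n): the rotation e_i ↦ e_{i+1} (e_n ↦ e_1)
cycSuc : ∀ {m} → Fin (suc m) → Fin (suc m)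
cycSuc {zero} zero = zero
cycSuc {suc m} zero = suc zero
cycSuc {suc m} (suc i) with cycSuc i
... | zero = zero
... | suc j = suc (suc j)

next : ∀ {n} → Fin n → Fin n
next {suc m} i = cycSuc i

-- Arcs (darts): (i , w) is the arc along edge e_{i+1} whose tail is w.
Arc : ℕ → Set
Arc n = Fin n × Vtx

tail : ∀ {n} → Arc n → Vtx
tail = proj₂

θ : ∀ {n} → Arc n → Arc n
θ (i , w) = (i , other w)

ρ : ∀ {n} → Arc n → Arc n
ρ (i , w) = (next i , w)

-- facial successor: the arc following a in the facial walk of its face
φ : ∀ {n} → Arc n → Arc n
φ a = ρ (θ a)

iter : ∀ {A : Set} → ℕ → (A → A) → A → A
iter zero f x = x
iter (suc k) f x = f (iter k f x)

arcEq : ∀ {n} → Arc n → Arc n → Bool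
arcEq {n} a b = ⌊ ≡-dec FinP._≟_ FinP._≟_ a b ⌋

anyBelow : ℕ → (ℕ → Bool) → Bool
anyBelow zero P = false
anyBelow (suc m) P = P m ∨ anyBelow m P

allArcs : ∀ {n} → (Arc n → Bool) → Bool
allArcs {zero} P = true
allArcs {suc n} P = P (zero , u) ∧ P (zero , v) ∧ allArcs {n} (λ { (i , w) → P (suc i , w) })

countArcs : ∀ {n} → (Arc n → Bool) → ℕ
countArcs {zero} P = 0
countArcs {suc n} P = (if P (zero , u) then 1 else 0) ℕ.+ (if P (zero , v) then 1 else 0)
  ℕ.+ countArcs {n} (λ { (i , w) → P (suc i , w) })

-- two arcs lie in the same face iff they lie in the same φ-orbit
-- (orbits have length ≤ number of arcs = 2n)
sameFace : ∀ {n} → Arc n → Arc n → Bool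
sameFace {n} a b = anyBelow (2 ℕ.* n) (λ k → arcEq (iter k φ a) b)

-- faces are represented by a canonical arc: the one of least code in the orbit
code : ∀ {n} → Arc n → ℕ
code {n} (i , w) = toℕ w ℕ.* n ℕ.+ toℕ i

isFace : ∀ {n} → Arc n → Bool
isFace {n} f = allArcs (λ b → not (sameFace f b) ∨ ⌊ code f ℕ.≤? code b ⌋)

Nb : ∀ {n} → Arc n → Vtx → Bool
Nb a w = ⌊ tail a FinP.≟ w ⌋

Mb : ∀ {n} → Arc n → Arc n → Bool
Mb a f = isFace f ∧ sameFace a f

degV : ∀ {n} → Vtx → ℕ
degV {n} w = countArcs {n} (λ a → Nb a w)

degF : ∀ {n} → Arc n → ℕ
degF {n} f = countArcs {n} (λ a → Mb a f)

-- The vertex–face walk, over a commutative ring R equipped with an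
-- "inverse square root" s : ℕ → R  (s k * s k * k ≈ 1 for k ≥ 1),
-- used to form D^{-1/2} and Δ^{-1/2}.

module Walk {c ℓ : Level} (R : CommutativeRing c ℓ) (s : ℕ → CommutativeRing.Carrier R) where
  open CommutativeRing R hiding (zero)
  open RawMonoidDefs +-rawMonoid using () renaming (_×_ to _·ℕ_)

  ι : ℕ → Carrier
  ι k = k ·ℕ 1#

  [_] : Bool → Carrier
  [ b ] = if b then 1# else 0#

  sumFin : ∀ m → (Fin m → Carrier) → Carrier
  sumFin zero f = 0#
  sumFin (suc m) f = f zero + sumFin m (λ i → f (suc i))

  sumV : (Vtx → Carrier) → Carrier
  sumV = sumFin 2

  sumA : ∀ {n} → (Arc n → Carrier) → Carrier
  sumA {n} f = sumFin n (λ i → f (i , u) + f (i , v))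

  sumF : ∀ {n} → (Arc n → Carrier) → Carrier
  sumF {n} f = sumA {n} (λ g → [ isFace g ] * f g)

  N̂ : ∀ {n} → Arc n → Vtx → Carrier
  N̂ {n} a w = [ Nb a w ] * s (degV {n} w)

  M̂ : ∀ {n} → Arc n → Arc n → Carrier
  M̂ {n} a f = [ Mb a f ] * s (degF {n} f)

  Q : ∀ {n} → Arc n → Arc n → Carrier
  Q {n} a b = sumV (λ w → N̂ {n} a w * N̂ {n} b w)

  P : ∀ {n} → Arc n → Arc n → Carrier
  P {n} a b = sumF {n} (λ f → M̂ {n} a f * M̂ {n} b f)

  I : ∀ {n} → Arc n → Arc n → Carrier
  I a b = [ arcEq a b ]

  two : Carrier
  two = 1# + 1#

  U : ∀ {n} → Arc n → Arc n → Carrier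
  U {n} a b = sumA {n} (λ c → (two * P {n} a c - I a c) * (two * Q {n} c b - I c b))

  e : Vtx → Vtx → Carrier
  e w w′ = [ ⌊ w FinP.≟ w′ ⌋ ]

  applyN̂ : ∀ {n} → (Vtx → Carrier) → Arc n → Carrier
  applyN̂ {n} x a = sumV (λ w → N̂ {n} a w * x w)

  applyU : ∀ {n} → (Arc n → Carrier) → Arc n → Carrier
  applyU {n} y a = sumA {n} (λ b → U {n} a b * y b)

  IsInvSqrt : Set ℓ
  IsInvSqrt = ∀ k → 1 ℕ.≤ k → s k * s k * ι k ≈ 1#

module Submission where

-- Let y = N̂ e_u.  Since the columns of N̂ are orthonormal, Q = N̂ N̂ᵀ fixes y,
-- so U y = (2P − I) y.  The matrix P averages a vector over the face of each
-- arc.  The facial walk is φ (i , w) = (i + 1 , other w), so it alternates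
-- between arcs with tail u and arcs with tail v: every face contains as many of
-- the former as of the latter.  Hence 2 P y is the constant vector s n and
-- U y = s n − y = N̂ e_v.

open import Defs
open import Level using (Level)
open import Data.Nat using (ℕ; _≤_; _<_; zero; suc; s≤s; z≤n)
open import Algebra.Bundles using (CommutativeRing)

import Data.Nat as ℕ
open import Data.Nat.Properties as ℕP using ()
open import Data.Nat.DivMod using (_%_; _/_; m≡m%n+[m/n]*n; m%n<n)
open import Data.Nat.Induction using (<-wellFounded)
open import Induction.WellFounded using (Acc; acc)
open import Data.Fin using (Fin; zero; suc; toℕ; inject₁; fromℕ; combine)
import Data.Fin.Properties as FinP
open import Data.Product using (_×_; _,_; proj₁; proj₂; ∃)
open import Data.Bool using (Bool; true; false; T; not; _∧_; _∨_; if_then_else_)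
open import Data.Bool.Properties using (T-∧; T-∨; T?)
open import Data.Sum using (inj₁; inj₂)
open import Data.Empty using (⊥-elim)
open import Function using (_∘_; Equivalence)
open import Relation.Nullary using (¬_; yes; no)
open import Relation.Nullary.Decidable using (⌊_⌋; toWitness; fromWitness)
open import Relation.Binary.PropositionalEquality using (_≡_; _≢_; refl; sym; trans; cong; cong₂; subst; module ≡-Reasoning)

open Equivalence using (to; from)

module Iterate {A : Set} (f : A → A) where

  iter-+ : ∀ k l x → iter (k ℕ.+ l) f x ≡ iter k f (iter l f x)
  iter-+ zero    l x = refl
  iter-+ (suc k) l x = cong f (iter-+ k l x)

  Reaches : A → A → Set
  Reaches x y = ∃ λ k → iter k f x ≡ y

  Reaches-refl : ∀ x → Reaches x x
  Reaches-refl x = 0 , refl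

  Reaches-trans : ∀ {x y z} → Reaches x y → Reaches y z → Reaches x z
  Reaches-trans {x} (k , refl) (l , refl) = l ℕ.+ k , iter-+ l k x

  module Periodic (p : ℕ) (periodic : ∀ x → iter (suc p) f x ≡ x) where

    iter-*-period : ∀ q x → iter (q ℕ.* suc p) f x ≡ x
    iter-*-period zero    x = refl
    iter-*-period (suc q) x = begin
      iter (suc p ℕ.+ q ℕ.* suc p) f x        ≡⟨ iter-+ (suc p) (q ℕ.* suc p) x ⟩
      iter (suc p) f (iter (q ℕ.* suc p) f x) ≡⟨ cong (iter (suc p) f) (iter-*-period q x) ⟩
      iter (suc p) f x                        ≡⟨ periodic x ⟩
      x                                       ∎
      where open ≡-Reasoning

    iter-%-period : ∀ k x → iter k f x ≡ iter (k % suc p) f x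
    iter-%-period k x = begin
      iter k f x
        ≡⟨ cong (λ j → iter j f x) (m≡m%n+[m/n]*n k (suc p)) ⟩
      iter (k % suc p ℕ.+ (k / suc p) ℕ.* suc p) f x
        ≡⟨ iter-+ (k % suc p) _ x ⟩
      iter (k % suc p) f (iter ((k / suc p) ℕ.* suc p) f x)
        ≡⟨ cong (iter (k % suc p) f) (iter-*-period (k / suc p) x) ⟩
      iter (k % suc p) f x
        ∎
      where open ≡-Reasoning

    Reaches-sym : ∀ {x y} → Reaches x y → Reaches y x
    Reaches-sym {x} (k , refl) = p ℕ.* k , (begin
      iter (p ℕ.* k) f (iter k f x) ≡⟨ iter-+ (p ℕ.* k) k x ⟨
      iter (p ℕ.* k ℕ.+ k) f x      ≡⟨ cong (λ j → iter j f x) (trans (ℕP.+-comm (p ℕ.* k) k) (ℕP.*-comm (suc p) k)) ⟩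
      iter (k ℕ.* suc p) f x        ≡⟨ iter-*-period k x ⟩
      x                             ∎)
      where open ≡-Reasoning

toℕ-cycSuc : ∀ {m} (i : Fin (suc m)) → toℕ i < m → toℕ (cycSuc i) ≡ suc (toℕ i)
toℕ-cycSuc {suc m} zero    _         = refl
toℕ-cycSuc {suc m} (suc i) (s≤s i<m) with cycSuc i | toℕ-cycSuc i i<m
... | suc j | eq = cong suc eq

cycSuc-last : ∀ {m} (i : Fin (suc m)) → toℕ i ≡ m → cycSuc i ≡ zero
cycSuc-last {zero}  zero    _  = refl
cycSuc-last {suc m} (suc i) eq with cycSuc i | cycSuc-last i (ℕP.suc-injective eq)
... | zero | refl = refl

cycSuc-inject₁ : ∀ {m} (i : Fin m) → cycSuc (inject₁ i) ≡ suc i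
cycSuc-inject₁ {m} i = FinP.toℕ-injective (begin
  toℕ (cycSuc (inject₁ i)) ≡⟨ toℕ-cycSuc (inject₁ i) (subst (_< m) (sym (FinP.toℕ-inject₁ i)) (FinP.toℕ<n i)) ⟩
  suc (toℕ (inject₁ i))    ≡⟨ cong suc (FinP.toℕ-inject₁ i) ⟩
  suc (toℕ i)              ∎)
  where open ≡-Reasoning

cycSuc-fromℕ : ∀ m → cycSuc (fromℕ m) ≡ zero
cycSuc-fromℕ m = cycSuc-last (fromℕ m) (FinP.toℕ-fromℕ m)

toℕ-iter-cycSuc : ∀ {m} k → k ≤ m → toℕ (iter k (cycSuc {m}) zero) ≡ k
toℕ-iter-cycSuc zero    _  = refl
toℕ-iter-cycSuc {m} (suc k) k<m = trans
  (toℕ-cycSuc _ (subst (_< m) (sym (toℕ-iter-cycSuc k (ℕP.<⇒≤ k<m))) k<m))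
  (cong suc (toℕ-iter-cycSuc k (ℕP.<⇒≤ k<m)))

iter-cycSuc-toℕ : ∀ {m} (i : Fin (suc m)) → iter (toℕ i) cycSuc zero ≡ i
iter-cycSuc-toℕ i = FinP.toℕ-injective (toℕ-iter-cycSuc (toℕ i) (FinP.toℕ≤pred[n] i))

cycSuc-periodic : ∀ {m} (i : Fin (suc m)) → iter (suc m) cycSuc i ≡ i
cycSuc-periodic {m} i = begin
  iter (suc m) cycSuc i                            ≡⟨ cong (iter (suc m) cycSuc) (iter-cycSuc-toℕ i) ⟨
  iter (suc m) cycSuc (iter (toℕ i) cycSuc zero)  ≡⟨ iter-+ (suc m) (toℕ i) zero ⟨
  iter (suc m ℕ.+ toℕ i) cycSuc zero              ≡⟨ cong (λ k → iter k cycSuc zero) (ℕP.+-comm (suc m) (toℕ i)) ⟩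
  iter (toℕ i ℕ.+ suc m) cycSuc zero              ≡⟨ iter-+ (toℕ i) (suc m) zero ⟩
  iter (toℕ i) cycSuc (iter (suc m) cycSuc zero)  ≡⟨ cong (iter (toℕ i) cycSuc) (cycSuc-last _ (toℕ-iter-cycSuc m ℕP.≤-refl)) ⟩
  iter (toℕ i) cycSuc zero                         ≡⟨ iter-cycSuc-toℕ i ⟩
  i                                                ∎
  where open ≡-Reasoning
        open Iterate cycSuc

other-involutive : ∀ w → other (other w) ≡ w
other-involutive zero       = refl
other-involutive (suc zero) = refl

iter-other-even : ∀ k w → iter (k ℕ.+ k) other w ≡ w
iter-other-even zero    w = refl
iter-other-even (suc k) w rewrite ℕP.+-suc k k = trans (other-involutive _) (iter-other-even k w)

iter-φ : ∀ {n} k (i : Fin n) w → iter k φ (i , w) ≡ (iter k next i , iter k other w)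
iter-φ zero    i w = refl
iter-φ (suc k) i w rewrite iter-φ k i w = refl

φ-periodic : ∀ {m} (a : Arc (suc m)) → iter (2 ℕ.* suc m) φ a ≡ a
φ-periodic {m} (i , w)
  rewrite ℕP.+-identityʳ (suc m) | iter-φ (suc m ℕ.+ suc m) i w | iter-other-even (suc m) w
        | Iterate.iter-+ cycSuc (suc m) (suc m) i | cycSuc-periodic i | cycSuc-periodic i = refl

anyBelow⁺ : ∀ {m} (P : ℕ → Bool) {k} → k < m → T (P k) → T (anyBelow m P)
anyBelow⁺ {suc m} P {k} k<m pk with k ℕ.≟ m
... | yes refl = from T-∨ (inj₁ pk)
... | no k≢m   = from T-∨ (inj₂ (anyBelow⁺ P (ℕP.≤∧≢⇒< (ℕP.≤-pred k<m) k≢m) pk))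

anyBelow⁻ : ∀ m (P : ℕ → Bool) → T (anyBelow m P) → ∃ λ k → k < m × T (P k)
anyBelow⁻ (suc m) P t with to T-∨ t
... | inj₁ pm = m , ℕP.n<1+n m , pm
... | inj₂ t′ with anyBelow⁻ m P t′
...   | k , k<m , pk = k , ℕP.m<n⇒m<1+n k<m , pk

allArcs⁻ : ∀ {n} (P : Arc n → Bool) → T (allArcs P) → ∀ a → T (P a)
allArcs⁻ {suc n} P t a with to (T-∧ {P (zero , u)}) t
... | pu , t′ with to (T-∧ {P (zero , v)}) t′
...   | pv , rest with a
...     | zero , zero     = pu
...     | zero , suc zero = pv
...     | suc i , w       = allArcs⁻ (λ b → P (suc (proj₁ b) , proj₂ b)) rest (i , w)

allArcs-counterexample : ∀ {n} (P : Arc n → Bool) → ¬ T (allArcs P) → ∃ λ a → ¬ T (P a)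
allArcs-counterexample {zero} P ¬all = ⊥-elim (¬all _)
allArcs-counterexample {suc n} P ¬all with T? (P (zero , u)) | T? (P (zero , v))
... | no ¬pu | _      = (zero , u) , ¬pu
... | yes _  | no ¬pv = (zero , v) , ¬pv
... | yes pu | yes pv with allArcs-counterexample (λ b → P (suc (proj₁ b) , proj₂ b))
                            (λ rest → ¬all (from (T-∧ {P (zero , u)}) (pu , from (T-∧ {P (zero , v)}) (pv , rest))))
...   | (i , w) , ¬p = (suc i , w) , ¬p

toℕ-combine≡code : ∀ {n} (i : Fin n) w → toℕ (combine w i) ≡ code (i , w)
toℕ-combine≡code {n} i w = trans (FinP.toℕ-combine w i) (cong (ℕ._+ toℕ i) (ℕP.*-comm n (toℕ w)))

code-injective : ∀ {n} (a b : Arc n) → code a ≡ code b → a ≡ b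
code-injective (i , w) (j , w′) eq
  with refl , refl ← FinP.combine-injective w i w′ j
         (FinP.toℕ-injective (trans (toℕ-combine≡code i w) (trans eq (sym (toℕ-combine≡code j w′))))) = refl

arcEq⁺ : ∀ {n} {a b : Arc n} → a ≡ b → T (arcEq a b)
arcEq⁺ = fromWitness

arcEq⁻ : ∀ {n} {a b : Arc n} → T (arcEq a b) → a ≡ b
arcEq⁻ = toWitness

T-injective : ∀ {x y} → (T x → T y) → (T y → T x) → x ≡ y
T-injective {false} {false} _ _ = refl
T-injective {false} {true}  _ g = ⊥-elim (g _)
T-injective {true}  {false} f _ = ⊥-elim (f _)
T-injective {true}  {true}  _ _ = refl

¬T-not-∨ : ∀ x y → ¬ T (not x ∨ y) → T x × ¬ T y
¬T-not-∨ false y h = ⊥-elim (h _)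
¬T-not-∨ true  y h = _ , h

module Faces (m : ℕ) where
  private
    n : ℕ
    n = suc m

  open Iterate (φ {n})
  -- suc (m + 1 * suc m) is the normal form of 2 * suc m
  open Periodic (m ℕ.+ 1 ℕ.* suc m) φ-periodic

  sameFace⁺ : ∀ {a b : Arc n} → Reaches a b → T (sameFace a b)
  sameFace⁺ {a} (k , refl) =
    anyBelow⁺ (λ j → arcEq (iter j φ a) (iter k φ a)) (m%n<n k (2 ℕ.* n)) (arcEq⁺ (sym (iter-%-period k a)))

  sameFace⁻ : ∀ {a b : Arc n} → T (sameFace a b) → Reaches a b
  sameFace⁻ {a} {b} t with anyBelow⁻ (2 ℕ.* n) (λ k → arcEq (iter k φ a) b) t
  ... | k , _ , eq = k , arcEq⁻ eq

  sameFace-φ : ∀ (c f : Arc n) → sameFace (φ c) f ≡ sameFace c f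
  sameFace-φ c f = T-injective
    (λ t → sameFace⁺ (Reaches-trans (1 , refl) (sameFace⁻ t)))
    (λ t → sameFace⁺ (Reaches-trans (Reaches-sym (1 , refl)) (sameFace⁻ t)))

  minimalIn : Arc n → Arc n → Bool
  minimalIn f b = not (sameFace f b) ∨ ⌊ code f ℕ.≤? code b ⌋

  isFace⁻ : ∀ {f b : Arc n} → T (isFace f) → Reaches f b → code f ≤ code b
  isFace⁻ {f} {b} t f↝b with to (T-∨ {not (sameFace f b)}) (allArcs⁻ (minimalIn f) t b)
  ... | inj₁ ¬sf = ⊥-elim (not-T (sameFace f b) ¬sf (sameFace⁺ f↝b))
    where not-T : ∀ x → T (not x) → ¬ T x
          not-T true () _
  ... | inj₂ le  = toWitness le

  not-isFace⇒smaller : ∀ {a : Arc n} → ¬ T (isFace a) → ∃ λ b → Reaches a b × code b < code a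
  not-isFace⇒smaller {a} ¬isf with allArcs-counterexample (minimalIn a) ¬isf
  ... | b , ¬pb with ¬T-not-∨ (sameFace a b) _ ¬pb
  ...   | sf , ¬le = b , sameFace⁻ sf , ℕP.≰⇒> (¬le ∘ fromWitness)

  faceOf : ∀ (a : Arc n) → Acc _<_ (code a) → ∃ λ f → T (isFace f) × Reaches a f
  faceOf a (acc rs) with T? (isFace a)
  ... | yes isf = a , isf , Reaches-refl a
  ... | no ¬isf with not-isFace⇒smaller ¬isf
  ...   | b , a↝b , b<a with faceOf b (rs b<a)
  ...     | f , isf , b↝f = f , isf , Reaches-trans a↝b b↝f

  face : Arc n → Arc n
  face a = proj₁ (faceOf a (<-wellFounded (code a)))

  face-unique : ∀ {a f : Arc n} → T (isFace f) → Reaches a f → f ≡ face a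
  face-unique {a} {f} isf a↝f with faceOf a (<-wellFounded (code a))
  ... | F , isF , a↝F = code-injective f F (ℕP.≤-antisym
    (isFace⁻ isf (Reaches-trans (Reaches-sym a↝f) a↝F))
    (isFace⁻ isF (Reaches-trans (Reaches-sym a↝F) a↝f)))

  Mb-face : ∀ (a : Arc n) → T (Mb a (face a))
  Mb-face a with faceOf a (<-wellFounded (code a))
  ... | F , isF , a↝F = from T-∧ (isF , sameFace⁺ a↝F)

  Mb⇒face : ∀ {a f : Arc n} → T (Mb a f) → f ≡ face a
  Mb⇒face {a} {f} t with to (T-∧ {isFace f}) t
  ... | isf , sf = face-unique isf (sameFace⁻ sf)

  Mb-φ : ∀ (c f : Arc n) → Mb (φ c) f ≡ Mb c f
  Mb-φ c f = cong (isFace f ∧_) (sameFace-φ c f)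

degV≡n : ∀ n w → degV {n} w ≡ n
degV≡n zero    w          = refl
degV≡n (suc n) zero       = cong suc (degV≡n n zero)
degV≡n (suc n) (suc zero) = cong suc (degV≡n n (suc zero))

countArcs-pos : ∀ {n} (P : Arc n → Bool) a → T (P a) → 1 ≤ countArcs P
countArcs-pos {suc n} P (zero , zero) t with P (zero , zero)
... | true  = s≤s z≤n
... | false = ⊥-elim t
countArcs-pos {suc n} P (zero , suc zero) t with P (zero , suc zero)
... | true  = ℕP.≤-trans (ℕP.m≤n+m 1 (if P (zero , zero) then 1 else 0)) (ℕP.m≤m+n _ _)
... | false = ⊥-elim t
countArcs-pos {suc n} P (suc i , w) t =
  ℕP.≤-trans (countArcs-pos (λ b → P (suc (proj₁ b) , proj₂ b)) (i , w) t) (ℕP.m≤n+m _ _)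

module VertexFaceWalk {c ℓ : Level} (R : CommutativeRing c ℓ) (s : ℕ → CommutativeRing.Carrier R) where
  open CommutativeRing R hiding (zero)
    renaming (refl to ≈-refl; sym to ≈-sym; trans to ≈-trans; reflexive to ≈-reflexive)
  open Walk R s
  open import Algebra.Properties.Ring ring using ([y-z]x≈yx-zx; -0#≈0#)
  open import Algebra.Properties.Semiring.Sum semiring
    using (sum; sum-syntax; sum-cong-≋; sum-cong-≗; ∑-distrib-+; ∑-comm; *-distribˡ-sum; *-distribʳ-sum;
           sum-replicate; sum-replicate-zero; sum-init-last)
  open import Algebra.Properties.Semiring.Mult semiring using (×-assoc-*; ×-congʳ; ×-homo-+; ×-homo-1) renaming (_×_ to _·ℕ_)
  open import Algebra.Properties.CommutativeSemigroup +-commutativeSemigroup using (interchange)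
  open import Algebra.Solver.CommutativeMonoid *-commutativeMonoid using (solve; _⊕_; _⊜_)
  open import Relation.Binary.Reasoning.Setoid setoid

  sumFin≡sum : ∀ k (f : Fin k → Carrier) → sumFin k f ≡ sum f
  sumFin≡sum zero    f = refl
  sumFin≡sum (suc k) f = cong (f zero +_) (sumFin≡sum k (f ∘ suc))

  sum-zero : ∀ {k} (f : Fin k → Carrier) → (∀ i → f i ≈ 0#) → sum f ≈ 0#
  sum-zero {k} f h = ≈-trans (sum-cong-≋ h) (sum-replicate-zero k)

  sum-pick : ∀ {k} (f : Fin k → Carrier) j → (∀ i → i ≢ j → f i ≈ 0#) → sum f ≈ f j
  sum-pick f zero    h = ≈-trans (+-congˡ (sum-zero (f ∘ suc) (λ i → h (suc i) λ ()))) (+-identityʳ _)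
  sum-pick f (suc j) h = ≈-trans
    (+-cong (h zero λ ()) (sum-pick (f ∘ suc) j (λ i i≢j → h (suc i) (i≢j ∘ FinP.suc-injective))))
    (+-identityˡ _)

  sum-const : ∀ k x → ∑[ i < k ] x ≈ ι k * x
  sum-const k x = begin
    ∑[ i < k ] x    ≈⟨ sum-replicate k ⟩
    k ·ℕ x          ≈⟨ ×-congʳ k (*-identityˡ x) ⟨
    k ·ℕ (1# * x)   ≈⟨ ×-assoc-* k 1# x ⟨
    ι k * x         ∎

  sum-cycSuc : ∀ m (g : Fin (suc m) → Carrier) → sum (g ∘ cycSuc) ≈ sum g
  sum-cycSuc m g = begin
    sum (g ∘ cycSuc)
      ≈⟨ sum-init-last (g ∘ cycSuc) ⟩
    sum (g ∘ cycSuc ∘ inject₁) + g (cycSuc (fromℕ m))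
      ≡⟨ cong₂ _+_ (sum-cong-≗ (cong g ∘ cycSuc-inject₁)) (cong g (cycSuc-fromℕ m)) ⟩
    sum (g ∘ suc) + g zero
      ≈⟨ +-comm _ _ ⟩
    sum g
      ∎

  []-T : ∀ {b} → T b → [ b ] ≈ 1#
  []-T {true} _ = ≈-refl

  []-¬T : ∀ {b} → ¬ T b → [ b ] ≈ 0#
  []-¬T {false} _ = ≈-refl
  []-¬T {true}  h = ⊥-elim (h _)

  []-*-T : ∀ {b} x → T b → [ b ] * x ≈ x
  []-*-T x t = ≈-trans (*-congʳ ([]-T t)) (*-identityˡ x)

  []-*-¬T : ∀ {b} x → ¬ T b → [ b ] * x ≈ 0#
  []-*-¬T x h = ≈-trans (*-congʳ ([]-¬T h)) (zeroˡ x)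

  two*x≈x+x : ∀ x → two * x ≈ x + x
  two*x≈x+x x = ≈-trans (distribʳ x 1# 1#) (+-cong (*-identityˡ x) (*-identityˡ x))

  two*x-x≈x : ∀ x → two * x - x ≈ x
  two*x-x≈x x = begin
    two * x - x      ≈⟨ +-congʳ (two*x≈x+x x) ⟩
    x + x - x        ≈⟨ +-assoc x x (- x) ⟩
    x + (x - x)      ≈⟨ +-congˡ (-‿inverseʳ x) ⟩
    x + 0#           ≈⟨ +-identityʳ x ⟩
    x                ∎

  ι-countArcs : ∀ {n} (P : Arc n → Bool) → ι (countArcs P) ≈ sumA (λ b → [ P b ])
  ι-countArcs {zero}  P = ≈-refl
  ι-countArcs {suc n} P = begin
    ι (countArcs P)
      ≈⟨ ×-homo-+ 1# (b2n (P (zero , u)) ℕ.+ b2n (P (zero , v))) _ ⟩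
    ι (b2n (P (zero , u)) ℕ.+ b2n (P (zero , v))) + ι (countArcs rest)
      ≈⟨ +-congʳ (×-homo-+ 1# (b2n (P (zero , u))) _) ⟩
    ι (b2n (P (zero , u))) + ι (b2n (P (zero , v))) + ι (countArcs rest)
      ≈⟨ +-cong (+-cong (ι-b2n _) (ι-b2n _)) (ι-countArcs rest) ⟩
    sumA (λ b → [ P b ])
      ∎
    where
      b2n : Bool → ℕ
      b2n b = if b then 1 else 0
      ι-b2n : ∀ b → ι (b2n b) ≈ [ b ]
      ι-b2n true  = ×-homo-1 1#
      ι-b2n false = ≈-refl
      rest : Arc n → Bool
      rest b = P (suc (proj₁ b) , proj₂ b)

  sumA≡∑ : ∀ {n} (f : Arc n → Carrier) → sumA f ≡ ∑[ i < n ] (f (i , u) + f (i , v))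
  sumA≡∑ {n} f = sumFin≡sum n _

  sumA≈∑∑ : ∀ {n} (f : Arc n → Carrier) → sumA f ≈ ∑[ i < n ] ∑[ w < 2 ] f (i , w)
  sumA≈∑∑ f = ≈-trans (≈-reflexive (sumA≡∑ f)) (sum-cong-≋ (λ i → +-congˡ (≈-sym (+-identityʳ (f (i , v))))))

  sumA-cong : ∀ {n} {f g : Arc n → Carrier} → (∀ b → f b ≈ g b) → sumA f ≈ sumA g
  sumA-cong {n} {f} {g} f≈g = begin
    sumA f                             ≡⟨ sumA≡∑ f ⟩
    ∑[ i < n ] (f (i , u) + f (i , v)) ≈⟨ sum-cong-≋ (λ i → +-cong (f≈g (i , u)) (f≈g (i , v))) ⟩
    ∑[ i < n ] (g (i , u) + g (i , v)) ≡⟨ sumA≡∑ g ⟨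
    sumA g                             ∎

  sumA-split : ∀ {n} (f : Arc n → Carrier) → sumA f ≈ ∑[ i < n ] f (i , u) + ∑[ i < n ] f (i , v)
  sumA-split f = ≈-trans (≈-reflexive (sumA≡∑ f)) (∑-distrib-+ (λ i → f (i , u)) (λ i → f (i , v)))

  sumA-+ : ∀ {n} (f g : Arc n → Carrier) → sumA (λ b → f b + g b) ≈ sumA f + sumA g
  sumA-+ {n} f g = begin
    sumA (λ b → f b + g b)                                  ≡⟨ sumA≡∑ (λ b → f b + g b) ⟩
    ∑[ i < n ] ((f (i , u) + g (i , u)) + (f (i , v) + g (i , v)))
                                                            ≈⟨ sum-cong-≋ (λ i → interchange (f (i , u)) (g (i , u)) (f (i , v)) (g (i , v))) ⟩
    ∑[ i < n ] ((f (i , u) + f (i , v)) + (g (i , u) + g (i , v)))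
                                                            ≈⟨ ∑-distrib-+ (λ i → f (i , u) + f (i , v)) (λ i → g (i , u) + g (i , v)) ⟩
    ∑[ i < n ] (f (i , u) + f (i , v)) + ∑[ i < n ] (g (i , u) + g (i , v))
                                                            ≡⟨ cong₂ _+_ (sumA≡∑ f) (sumA≡∑ g) ⟨
    sumA f + sumA g                                         ∎

  *-distribˡ-sumA : ∀ {n} x (f : Arc n → Carrier) → x * sumA f ≈ sumA (λ b → x * f b)
  *-distribˡ-sumA {n} x f = begin
    x * sumA f                                   ≡⟨ cong (x *_) (sumA≡∑ f) ⟩
    x * ∑[ i < n ] (f (i , u) + f (i , v))       ≈⟨ *-distribˡ-sum x (λ i → f (i , u) + f (i , v)) ⟩
    ∑[ i < n ] (x * (f (i , u) + f (i , v)))     ≈⟨ sum-cong-≋ (λ i → distribˡ x (f (i , u)) (f (i , v))) ⟩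
    ∑[ i < n ] (x * f (i , u) + x * f (i , v))   ≡⟨ sumA≡∑ (λ b → x * f b) ⟨
    sumA (λ b → x * f b)                         ∎

  *-distribʳ-sumA : ∀ {n} x (f : Arc n → Carrier) → sumA f * x ≈ sumA (λ b → f b * x)
  *-distribʳ-sumA x f =
    ≈-trans (*-comm _ x) (≈-trans (*-distribˡ-sumA x f) (sumA-cong (λ b → *-comm x (f b))))

  sumA-∑-comm : ∀ {n k} (F : Arc n → Fin k → Carrier) →
                sumA (λ b → ∑[ j < k ] F b j) ≈ ∑[ j < k ] sumA (λ b → F b j)
  sumA-∑-comm {n} {k} F = begin
    sumA (λ b → ∑[ j < k ] F b j)                                    ≡⟨ sumA≡∑ (λ b → ∑[ j < k ] F b j) ⟩
    ∑[ i < n ] (∑[ j < k ] F (i , u) j + ∑[ j < k ] F (i , v) j)     ≈⟨ sum-cong-≋ (λ i → ∑-distrib-+ (F (i , u)) (F (i , v))) ⟨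
    ∑[ i < n ] ∑[ j < k ] (F (i , u) j + F (i , v) j)                ≈⟨ ∑-comm (λ i j → F (i , u) j + F (i , v) j) ⟩
    ∑[ j < k ] ∑[ i < n ] (F (i , u) j + F (i , v) j)                ≡⟨ sum-cong-≗ (λ j → sumA≡∑ (λ b → F b j)) ⟨
    ∑[ j < k ] sumA (λ b → F b j)                                    ∎

  sumA-comm : ∀ {n} (F : Arc n → Arc n → Carrier) →
              sumA (λ b → sumA (λ d → F b d)) ≈ sumA (λ d → sumA (λ b → F b d))
  sumA-comm {n} F = begin
    sumA (λ b → sumA (λ d → F b d))
      ≈⟨ sumA-cong (λ b → ≈-reflexive (sumA≡∑ (F b))) ⟩
    sumA (λ b → ∑[ i < n ] (F b (i , u) + F b (i , v)))
      ≈⟨ sumA-∑-comm (λ b i → F b (i , u) + F b (i , v)) ⟩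
    ∑[ i < n ] sumA (λ b → F b (i , u) + F b (i , v))
      ≈⟨ sum-cong-≋ (λ i → sumA-+ (λ b → F b (i , u)) (λ b → F b (i , v))) ⟩
    ∑[ i < n ] (sumA (λ b → F b (i , u)) + sumA (λ b → F b (i , v)))
      ≡⟨ sumA≡∑ (λ d → sumA (λ b → F b d)) ⟨
    sumA (λ d → sumA (λ b → F b d))
      ∎

  sumA-pick : ∀ {n} (f : Arc n → Carrier) (a : Arc n) → (∀ b → b ≢ a → f b ≈ 0#) → sumA f ≈ f a
  sumA-pick {n} f (j , w) others = begin
    sumA f                               ≈⟨ sumA≈∑∑ f ⟩
    ∑[ i < n ] ∑[ w′ < 2 ] f (i , w′)    ≈⟨ sum-pick (λ i → ∑[ w′ < 2 ] f (i , w′)) j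
                                              (λ i i≢j → sum-zero (λ w′ → f (i , w′)) (λ w′ → others (i , w′) (i≢j ∘ cong proj₁))) ⟩
    ∑[ w′ < 2 ] f (j , w′)               ≈⟨ sum-pick (λ w′ → f (j , w′)) w (λ w′ w′≢w → others (j , w′) (w′≢w ∘ cong proj₂)) ⟩
    f (j , w)                            ∎

  sumA-matrix-assoc : ∀ {n} (x : Arc n → Carrier) (Y : Arc n → Arc n → Carrier) (g : Arc n → Carrier) →
                      sumA (λ b → sumA (λ c → x c * Y c b) * g b) ≈ sumA (λ c → x c * sumA (λ b → Y c b * g b))
  sumA-matrix-assoc x Y g = begin
    sumA (λ b → sumA (λ c → x c * Y c b) * g b)    ≈⟨ sumA-cong (λ b → *-distribʳ-sumA (g b) (λ c → x c * Y c b)) ⟩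
    sumA (λ b → sumA (λ c → x c * Y c b * g b))    ≈⟨ sumA-cong (λ b → sumA-cong (λ c → *-assoc (x c) (Y c b) (g b))) ⟩
    sumA (λ b → sumA (λ c → x c * (Y c b * g b)))  ≈⟨ sumA-comm (λ b c → x c * (Y c b * g b)) ⟩
    sumA (λ c → sumA (λ b → x c * (Y c b * g b)))  ≈⟨ sumA-cong (λ c → *-distribˡ-sumA (x c) (λ b → Y c b * g b)) ⟨
    sumA (λ c → x c * sumA (λ b → Y c b * g b))    ∎

  applyU-cong : ∀ {n} {y y′ : Arc n → Carrier} → (∀ b → y b ≈ y′ b) → ∀ a → applyU y a ≈ applyU y′ a
  applyU-cong {n} y≈y′ a = sumA-cong (λ b → *-congˡ {U {n} a b} (y≈y′ b))

  reflection : ∀ {n} (X g : Arc n → Carrier) (c : Arc n) →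
               sumA (λ b → (two * X b - I c b) * g b) ≈ two * sumA (λ b → X b * g b) - g c
  reflection X g c = begin
    sumA (λ b → (two * X b - I c b) * g b)
      ≈⟨ sumA-cong (λ b → [y-z]x≈yx-zx (g b) (two * X b) (I c b)) ⟩
    sumA (λ b → two * X b * g b - I c b * g b)
      ≈⟨ sumA-+ (λ b → two * X b * g b) (λ b → - (I c b * g b)) ⟩
    sumA (λ b → two * X b * g b) + sumA (λ b → - (I c b * g b))
      ≈⟨ +-cong (≈-trans (sumA-cong (λ b → *-assoc two (X b) (g b))) (≈-sym (*-distribˡ-sumA two (λ b → X b * g b))))
                (sumA-pick (λ b → - (I c b * g b)) c off-diagonal) ⟩
    two * sumA (λ b → X b * g b) - I c c * g c
      ≈⟨ +-congˡ (-‿cong ([]-*-T (g c) (arcEq⁺ refl))) ⟩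
    two * sumA (λ b → X b * g b) - g c
      ∎
    where
      off-diagonal : ∀ b → b ≢ c → - (I c b * g b) ≈ 0#
      off-diagonal b b≢c = ≈-trans (-‿cong ([]-*-¬T (g b) (b≢c ∘ sym ∘ arcEq⁻))) -0#≈0#

  module Transfer (inv : IsInvSqrt) (m : ℕ) where
    open Faces m

    private
      n : ℕ
      n = suc m

    s-n-inverse : s n * s n * ι n ≈ 1#
    s-n-inverse = inv n (s≤s z≤n)

    N̂-diag : ∀ i w → N̂ {n} (i , w) w ≈ s n
    N̂-diag i w = ≈-trans ([]-*-T _ (fromWitness refl)) (≈-reflexive (cong s (degV≡n n w)))

    N̂-offdiag : ∀ i {w′ w} → w′ ≢ w → N̂ {n} (i , w′) w ≈ 0#
    N̂-offdiag i w′≢w = []-*-¬T _ (w′≢w ∘ toWitness)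

    e-diag : ∀ w → e w w ≈ 1#
    e-diag w = []-T (fromWitness refl)

    e-offdiag : ∀ {w w′} → w ≢ w′ → e w w′ ≈ 0#
    e-offdiag w≢w′ = []-¬T (w≢w′ ∘ toWitness)

    ∑-*-e : ∀ (x : Vtx → Carrier) w → sumV (λ w′ → x w′ * e w w′) ≈ x w
    ∑-*-e x w = begin
      sumV (λ w′ → x w′ * e w w′)
        ≡⟨ sumFin≡sum 2 (λ w′ → x w′ * e w w′) ⟩
      ∑[ w′ < 2 ] (x w′ * e w w′)
        ≈⟨ sum-pick (λ w′ → x w′ * e w w′) w (λ w′ w′≢w → ≈-trans (*-congˡ (e-offdiag (w′≢w ∘ sym))) (zeroʳ _)) ⟩
      x w * e w w
        ≈⟨ ≈-trans (*-congˡ (e-diag w)) (*-identityʳ _) ⟩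
      x w
        ∎

    applyN̂-e : ∀ w (a : Arc n) → applyN̂ (e w) a ≈ N̂ a w
    applyN̂-e w a = ∑-*-e (N̂ a) w

    sumA-*-N̂ : ∀ (g : Arc n → Carrier) w → sumA (λ c → g c * N̂ c w) ≈ s n * ∑[ i < n ] g (i , w)
    sumA-*-N̂ g w = begin
      sumA (λ c → g c * N̂ c w)
        ≈⟨ sumA≈∑∑ (λ c → g c * N̂ c w) ⟩
      ∑[ i < n ] ∑[ w′ < 2 ] (g (i , w′) * N̂ (i , w′) w)
        ≈⟨ sum-cong-≋ (λ i → sum-pick (λ w′ → g (i , w′) * N̂ (i , w′) w) w
                               (λ w′ w′≢w → ≈-trans (*-congˡ (N̂-offdiag i w′≢w)) (zeroʳ _))) ⟩
      ∑[ i < n ] (g (i , w) * N̂ (i , w) w)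
        ≈⟨ sum-cong-≋ (λ i → ≈-trans (*-congˡ (N̂-diag i w)) (*-comm (g (i , w)) (s n))) ⟩
      ∑[ i < n ] (s n * g (i , w))
        ≈⟨ *-distribˡ-sum (s n) (λ i → g (i , w)) ⟨
      s n * ∑[ i < n ] g (i , w)
        ∎

    N̂-orthonormal : ∀ w′ w → sumA {n} (λ b → N̂ b w′ * N̂ b w) ≈ e w w′
    N̂-orthonormal w′ w with w′ FinP.≟ w
    ... | yes refl = begin
      sumA {n} (λ b → N̂ b w * N̂ b w)    ≈⟨ sumA-*-N̂ (λ b → N̂ b w) w ⟩
      s n * ∑[ i < n ] N̂ (i , w) w       ≈⟨ *-congˡ (≈-trans (sum-cong-≋ (λ i → N̂-diag i w)) (sum-const n (s n))) ⟩
      s n * (ι n * s n)                  ≈⟨ solve 2 (λ x k → x ⊕ (k ⊕ x) ⊜ (x ⊕ x) ⊕ k) ≈-refl (s n) (ι n) ⟩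
      s n * s n * ι n                    ≈⟨ s-n-inverse ⟩
      1#                                 ≈⟨ e-diag w ⟨
      e w w                              ∎
    ... | no w′≢w = begin
      sumA {n} (λ b → N̂ b w′ * N̂ b w)   ≈⟨ sumA-*-N̂ (λ b → N̂ b w′) w ⟩
      s n * ∑[ i < n ] N̂ (i , w) w′      ≈⟨ *-congˡ (sum-zero (λ i → N̂ (i , w) w′) (λ i → N̂-offdiag i (w′≢w ∘ sym))) ⟩
      s n * 0#                           ≈⟨ zeroʳ _ ⟩
      0#                                 ≈⟨ e-offdiag (w′≢w ∘ sym) ⟨
      e w w′                             ∎

    Q-fixes-N̂ : ∀ (c : Arc n) w → sumA (λ b → Q c b * N̂ b w) ≈ N̂ c w
    Q-fixes-N̂ c w = begin
      sumA (λ b → Q c b * N̂ b w)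
        ≈⟨ sumA-cong {n} Q-expand ⟩
      sumA {n} (λ b → ∑[ w′ < 2 ] (N̂ c w′ * (N̂ b w′ * N̂ b w)))
        ≈⟨ sumA-∑-comm {n} (λ b w′ → N̂ c w′ * (N̂ b w′ * N̂ b w)) ⟩
      ∑[ w′ < 2 ] sumA {n} (λ b → N̂ c w′ * (N̂ b w′ * N̂ b w))
        ≈⟨ sum-cong-≋ (λ w′ → ≈-trans (≈-sym (*-distribˡ-sumA {n} (N̂ c w′) (λ b → N̂ b w′ * N̂ b w)))
                                      (*-congˡ (N̂-orthonormal w′ w))) ⟩
      ∑[ w′ < 2 ] (N̂ c w′ * e w w′)
        ≡⟨ sumFin≡sum 2 (λ w′ → N̂ c w′ * e w w′) ⟨
      applyN̂ (e w) c
        ≈⟨ applyN̂-e w c ⟩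
      N̂ c w
        ∎
      where
        Q-expand : ∀ b → Q c b * N̂ b w ≈ ∑[ w′ < 2 ] (N̂ c w′ * (N̂ b w′ * N̂ b w))
        Q-expand b = begin
          Q c b * N̂ b w                                  ≡⟨ cong (_* N̂ b w) (sumFin≡sum 2 (λ w′ → N̂ c w′ * N̂ b w′)) ⟩
          ∑[ w′ < 2 ] (N̂ c w′ * N̂ b w′) * N̂ b w          ≈⟨ *-distribʳ-sum (N̂ b w) (λ w′ → N̂ c w′ * N̂ b w′) ⟩
          ∑[ w′ < 2 ] (N̂ c w′ * N̂ b w′ * N̂ b w)          ≈⟨ sum-cong-≋ (λ w′ → *-assoc (N̂ c w′) (N̂ b w′) (N̂ b w)) ⟩
          ∑[ w′ < 2 ] (N̂ c w′ * (N̂ b w′ * N̂ b w))        ∎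

    reflection-fixes-N̂ : ∀ (c : Arc n) w → sumA (λ b → (two * Q c b - I c b) * N̂ b w) ≈ N̂ c w
    reflection-fixes-N̂ c w = ≈-trans (reflection (Q c) (λ b → N̂ b w) c)
                                     (≈-trans (+-congʳ (*-congˡ (Q-fixes-N̂ c w))) (two*x-x≈x (N̂ c w)))

    P-average : ∀ (a : Arc n) (g : Arc n → Carrier) →
                sumA (λ c → P a c * g c) ≈ s (degF (face a)) * (s (degF (face a)) * sumA (λ c → [ Mb c (face a) ] * g c))
    P-average a g = begin
      sumA (λ c → P a c * g c)
        ≈⟨ sumA-cong (λ c → *-congʳ {g c} (sumA-cong (λ f → ≈-sym (*-assoc [ isFace f ] (M̂ a f) (M̂ c f))))) ⟩
      sumA (λ c → sumA (λ f → [ isFace f ] * M̂ a f * M̂ c f) * g c)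
        ≈⟨ sumA-matrix-assoc (λ f → [ isFace f ] * M̂ a f) (λ f c → M̂ c f) g ⟩
      sumA (λ f → [ isFace f ] * M̂ a f * sumA (λ c → M̂ c f * g c))
        ≈⟨ sumA-pick (λ f → [ isFace f ] * M̂ a f * sumA (λ c → M̂ c f * g c)) F off-face ⟩
      [ isFace F ] * M̂ a F * sumA (λ c → M̂ c F * g c)
        ≈⟨ *-cong (≈-trans ([]-*-T (M̂ a F) (proj₁ (to (T-∧ {isFace F}) (Mb-face a)))) ([]-*-T σ (Mb-face a)))
                  (≈-trans (sumA-cong (λ c → pull-σ [ Mb c F ] (g c))) (≈-sym (*-distribˡ-sumA σ (λ c → [ Mb c F ] * g c)))) ⟩
      σ * (σ * sumA (λ c → [ Mb c F ] * g c))
        ∎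
      where
        F : Arc n
        F = face a
        σ : Carrier
        σ = s (degF F)
        off-face : ∀ f → f ≢ F → [ isFace f ] * M̂ a f * sumA (λ c → M̂ c f * g c) ≈ 0#
        off-face f f≢F = ≈-trans (*-congʳ (≈-trans (*-congˡ ([]-*-¬T (s (degF f)) (f≢F ∘ Mb⇒face))) (zeroʳ _))) (zeroˡ _)
        pull-σ : ∀ x y → x * σ * y ≈ σ * (x * y)
        pull-σ = solve 3 (λ z x y → (x ⊕ z) ⊕ y ⊜ z ⊕ (x ⊕ y)) ≈-refl σ

    faceTailCount : Vtx → Arc n → Carrier
    faceTailCount w f = ∑[ i < n ] [ Mb (i , w) f ]

    -- φ maps the arcs of a face with tail u bijectively onto those with tail v
    faceTailCount-u≈v : ∀ f → faceTailCount u f ≈ faceTailCount v f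
    faceTailCount-u≈v f = begin
      ∑[ i < n ] [ Mb (i , u) f ]          ≡⟨ sum-cong-≗ (λ i → cong [_] (sym (Mb-φ (i , u) f))) ⟩
      ∑[ i < n ] [ Mb (cycSuc i , v) f ]   ≈⟨ sum-cycSuc m (λ i → [ Mb (i , v) f ]) ⟩
      ∑[ i < n ] [ Mb (i , v) f ]          ∎

    two*faceTailCount : ∀ w f → two * faceTailCount w f ≈ ι (degF f)
    two*faceTailCount w f = begin
      two * faceTailCount w f                      ≈⟨ two*x≈x+x (faceTailCount w f) ⟩
      faceTailCount w f + faceTailCount w f        ≈⟨ balanced w ⟩
      faceTailCount u f + faceTailCount v f        ≈⟨ sumA-split (λ c → [ Mb c f ]) ⟨
      sumA (λ c → [ Mb c f ])                      ≈⟨ ι-countArcs (λ c → Mb c f) ⟨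
      ι (degF f)                                   ∎
      where
        balanced : ∀ w → faceTailCount w f + faceTailCount w f ≈ faceTailCount u f + faceTailCount v f
        balanced zero       = +-congˡ (faceTailCount-u≈v f)
        balanced (suc zero) = +-congʳ (≈-sym (faceTailCount-u≈v f))

    two*P-N̂ : ∀ (a : Arc n) w → two * sumA (λ c → P a c * N̂ c w) ≈ s n
    two*P-N̂ a w = begin
      two * sumA (λ c → P a c * N̂ c w)
        ≈⟨ *-congˡ (P-average a (λ c → N̂ c w)) ⟩
      two * (σ * (σ * sumA (λ c → [ Mb c F ] * N̂ c w)))
        ≈⟨ *-congˡ (*-congˡ (*-congˡ (sumA-*-N̂ (λ c → [ Mb c F ]) w))) ⟩
      two * (σ * (σ * (s n * faceTailCount w F)))
        ≈⟨ solve 4 (λ t x y k → t ⊕ (x ⊕ (x ⊕ (y ⊕ k))) ⊜ ((x ⊕ x) ⊕ (t ⊕ k)) ⊕ y) ≈-refl two σ (s n) (faceTailCount w F) ⟩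
      σ * σ * (two * faceTailCount w F) * s n
        ≈⟨ *-congʳ (*-congˡ (two*faceTailCount w F)) ⟩
      σ * σ * ι (degF F) * s n
        ≈⟨ *-congʳ (inv (degF F) (countArcs-pos (λ c → Mb c F) a (Mb-face a))) ⟩
      1# * s n
        ≈⟨ *-identityˡ (s n) ⟩
      s n
        ∎
      where
        F : Arc n
        F = face a
        σ : Carrier
        σ = s (degF F)

    N̂-complement : ∀ (a : Arc n) → s n - N̂ a u ≈ N̂ a v
    N̂-complement (i , zero) = begin
      s n - N̂ (i , u) u    ≈⟨ +-congˡ (-‿cong (N̂-diag i u)) ⟩
      s n - s n            ≈⟨ -‿inverseʳ (s n) ⟩
      0#                   ≈⟨ N̂-offdiag i {u} {v} (λ ()) ⟨
      N̂ (i , u) v          ∎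
    N̂-complement (i , suc zero) = begin
      s n - N̂ (i , v) u    ≈⟨ +-congˡ (≈-trans (-‿cong (N̂-offdiag i {v} {u} (λ ()))) -0#≈0#) ⟩
      s n + 0#             ≈⟨ +-identityʳ (s n) ⟩
      s n                  ≈⟨ N̂-diag i v ⟨
      N̂ (i , v) v          ∎

    U-transfers : ∀ (a : Arc n) → applyU (λ b → N̂ b u) a ≈ N̂ a v
    U-transfers a = begin
      applyU (λ b → N̂ b u) a
        ≈⟨ sumA-matrix-assoc (λ c → two * P a c - I a c) (λ c b → two * Q c b - I c b) (λ b → N̂ b u) ⟩
      sumA (λ c → (two * P a c - I a c) * sumA (λ b → (two * Q c b - I c b) * N̂ b u))
        ≈⟨ sumA-cong (λ c → *-congˡ {two * P a c - I a c} (reflection-fixes-N̂ c u)) ⟩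
      sumA (λ c → (two * P a c - I a c) * N̂ c u)
        ≈⟨ reflection (P a) (λ c → N̂ c u) a ⟩
      two * sumA (λ c → P a c * N̂ c u) - N̂ a u
        ≈⟨ +-congʳ (two*P-N̂ a u) ⟩
      s n - N̂ a u
        ≈⟨ N̂-complement a ⟩
      N̂ a v
        ∎

theorem7p1 : {c ℓ : Level} (R : CommutativeRing c ℓ) (s : ℕ → CommutativeRing.Carrier R) →
    Walk.IsInvSqrt R s →
    (n : ℕ) → 2 ≤ n →
    (a : Arc n) →
    CommutativeRing._≈_ R (Walk.applyU R s {n} (Walk.applyN̂ R s {n} (Walk.e R s u)) a) (Walk.applyN̂ R s {n} (Walk.e R s v) a)
theorem7p1 R s inv (suc m) _ a = begin
  applyU (applyN̂ (e u)) a     ≈⟨ applyU-cong (applyN̂-e u) a ⟩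
  applyU (λ b → N̂ b u) a      ≈⟨ U-transfers a ⟩
  N̂ a v                       ≈⟨ applyN̂-e v a ⟨
  applyN̂ (e v) a              ∎
  where
    open CommutativeRing R using (setoid)
    open Walk R s
    open VertexFaceWalk R s
    open Transfer inv m
    open import Relation.Binary.Reasoning.Setoid setoid
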